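{- For all ternary signed-digit encodings $\alpha,\beta:\mathbb{N}\to\{\bar1,0,1\}$, we have $\langle\!\langle\mathrm{mid}(\alpha,\beta)\rangle\!\rangle=\langle\!\langle\alpha\rangle\!\rangle\oplus\langle\!\langle\beta\rangle\!\rangle$ in the interval object $\mathbb{I}$.
   Context: Work in constructive type theory with function extensionality. An interval object is a set $\mathbb{I}$ with binary $\oplus$, $M:\mathbb{I}^{\mathbb{N}}\to\mathbb{I}$, points $-1,+1$, such that $\oplus$ is idempotent, commutative, transpositional ($(a\oplus b)\oplus(c\oplus d)=(a\oplus c)\oplus(b\oplus d)$) and cancellative; $M(\alpha)=\alpha_0\oplus M(\mathrm{tail}\,\alpha)$; if $\beta_i=\alpha_i\oplus\beta_{i+1}$ for all $i$ then $\beta_0=M(\alpha)$; and for every set $B$ with $\oplus_B,M_B,s,t$ satisfying these conditions there is a unique $h:\mathbb{I}\to B$ with $h(-1)=s$, $h(+1)=t$, $h(a\oplus b)=h(a)\oplus_B h(b)$. Fix one; $0:=-1\oplus+1$. Ternary digits $\{\bar1,0,1\}$ denote $-1,0,1$; $\langle\bar1\rangle=-1,\langle0\rangle=0,\langle1\rangle=+1$; $\langle\!\langle\alpha\rangle\!\rangle:=M(n\mapsto\langle\alpha_n\rangle)$. Quinary digits are $\{ -2,-1,0,1,2\}$; $\mathrm{add3}(a,b)$ is the integer sum of two ternary digits. Define $d:\{ -2,\dots,2\}^2\to\{\bar1,0,1\}\times\{ -2,\dots,2\}$ by $d(-2,y)=(\bar1,y)$, $d(0,y)=(0,y)$, $d(2,y)=(1,y)$,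 $d(-1,-2)=(\bar1,0)$, $d(-1,-1)=(\bar1,1)$, $d(-1,0)=(0,-2)$, $d(-1,1)=(0,-1)$, $d(-1,2)=(0,0)$, $d(1,-2)=(0,0)$, $d(1,-1)=(0,1)$, $d(1,0)=(0,2)$, $d(1,1)=(1,-1)$, $d(1,2)=(1,0)$. For $\gamma:\mathbb{N}\to\{ -2,\dots,2\}$, define $\mathrm{div2}(\gamma)$ by recursion on the index: $\mathrm{div2}(\gamma)_0:=\pi_1 d(\gamma_0,\gamma_1)$ and $\mathrm{div2}(\gamma)_{n+1}:=\mathrm{div2}(\pi_2 d(\gamma_0,\gamma_1)::\mathrm{tail}(\mathrm{tail}\,\gamma))_n$ (where $x::\gamma$ prepends $x$). Finally $\mathrm{mid}(\alpha,\beta):=\mathrm{div2}(n\mapsto\mathrm{add3}(\alpha_n,\beta_n))$. -}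

module Defs where

open import Data.Nat using (ℕ; zero; suc)
open import Data.Product using (Σ; _×_; _,_; proj₁; proj₂)
open import Relation.Binary.PropositionalEquality using (_≡_)

head : {A : Set} → (ℕ → A) → A
head α = α 0

tail : {A : Set} → (ℕ → A) → (ℕ → A)
tail α n = α (suc n)

_∷ₛ_ : {A : Set} → A → (ℕ → A) → (ℕ → A)
(x ∷ₛ γ) zero    = x
(x ∷ₛ γ) (suc n) = γ n

infixr 5 _∷ₛ_

record IsIterativeMidpoint {B : Set} (_⊕_ : B → B → B) (M : (ℕ → B) → B) : Set where
  field
    idem     : ∀ a → a ⊕ a ≡ a
    comm     : ∀ a b → a ⊕ b ≡ b ⊕ a
    transp   : ∀ a b c d → (a ⊕ b) ⊕ (c ⊕ d) ≡ (a ⊕ c) ⊕ (b ⊕ d)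
    cancel   : ∀ a b c → a ⊕ c ≡ b ⊕ c → a ≡ b
    M-eq     : ∀ α → M α ≡ head α ⊕ M (tail α)
    M-unique : ∀ (α β : ℕ → B) → (∀ i → β i ≡ α i ⊕ β (suc i)) → β 0 ≡ M α

IsMidHom : {I B : Set} → (I → I → I) → (B → B → B) → I → I → B → B → (I → B) → Set
IsMidHom _⊕_ _⊕B_ l r s t h = (h l ≡ s) × (h r ≡ t) × (∀ a b → h (a ⊕ b) ≡ h a ⊕B h b)

record IntervalObject : Set₁ where
  field
    𝕀     : Set
    _⊕_   : 𝕀 → 𝕀 → 𝕀
    M     : (ℕ → 𝕀) → 𝕀
    -1ᵢ   : 𝕀
    +1ᵢ   : 𝕀
    isIM  : IsIterativeMidpoint _⊕_ M
    univ-exists : (B : Set) (_⊕B_ : B → B → B) (MB : (ℕ → B) → B) (s t : B) →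
                  IsIterativeMidpoint _⊕B_ MB →
                  Σ (𝕀 → B) (IsMidHom _⊕_ _⊕B_ -1ᵢ +1ᵢ s t)
    univ-unique : (B : Set) (_⊕B_ : B → B → B) (MB : (ℕ → B) → B) (s t : B) →
                  IsIterativeMidpoint _⊕B_ MB →
                  (h h' : 𝕀 → B) →
                  IsMidHom _⊕_ _⊕B_ -1ᵢ +1ᵢ s t h →
                  IsMidHom _⊕_ _⊕B_ -1ᵢ +1ᵢ s t h' →
                  ∀ x → h x ≡ h' x

  0ᵢ : 𝕀
  0ᵢ = -1ᵢ ⊕ +1ᵢ

data 𝟛 : Set where
  ₋1 ₀ ₁ : 𝟛

data 𝟝 : Set where
  ₋2 ₋1 ₀ ₁ ₂ : 𝟝

add3 : 𝟛 → 𝟛 → 𝟝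
add3 𝟛.₋1 𝟛.₋1 = ₋2
add3 𝟛.₋1 𝟛.₀  = ₋1
add3 𝟛.₋1 𝟛.₁  = ₀
add3 𝟛.₀  𝟛.₋1 = ₋1
add3 𝟛.₀  𝟛.₀  = ₀
add3 𝟛.₀  𝟛.₁  = ₁
add3 𝟛.₁  𝟛.₋1 = ₀
add3 𝟛.₁  𝟛.₀  = ₁
add3 𝟛.₁  𝟛.₁  = ₂

d : 𝟝 → 𝟝 → 𝟛 × 𝟝
d ₋2 y  = 𝟛.₋1 , y
d ₀  y  = 𝟛.₀  , y
d ₂  y  = 𝟛.₁  , y
d ₋1 ₋2 = 𝟛.₋1 , ₀
d ₋1 ₋1 = 𝟛.₋1 , ₁
d ₋1 ₀  = 𝟛.₀  , ₋2
d ₋1 ₁  = 𝟛.₀  , ₋1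
d ₋1 ₂  = 𝟛.₀  , ₀
d ₁  ₋2 = 𝟛.₀  , ₀
d ₁  ₋1 = 𝟛.₀  , ₁
d ₁  ₀  = 𝟛.₀  , ₂
d ₁  ₁  = 𝟛.₁  , ₋1
d ₁  ₂  = 𝟛.₁  , ₀

div2 : (ℕ → 𝟝) → (ℕ → 𝟛)
div2 γ zero    = proj₁ (d (γ 0) (γ 1))
div2 γ (suc n) = div2 (proj₂ (d (γ 0) (γ 1)) ∷ₛ tail (tail γ)) n

mid : (ℕ → 𝟛) → (ℕ → 𝟛) → (ℕ → 𝟛)
mid α β = div2 (λ n → add3 (α n) (β n))

module _ (IO : IntervalObject) where
  open IntervalObject IO

  ⟨_⟩ : 𝟛 → 𝕀
  ⟨ 𝟛.₋1 ⟩ = -1ᵢ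
  ⟨ 𝟛.₀  ⟩ = 0ᵢ
  ⟨ 𝟛.₁  ⟩ = +1ᵢ

  ⟪_⟫ : (ℕ → 𝟛) → 𝕀
  ⟪ α ⟫ = M (λ n → ⟨ α n ⟩)

-- Quinary digit k denotes k/2, so ⟨ add3 a b ⟩₅ = ⟨ a ⟩ ⊕ ⟨ b ⟩, and since M commutes with ⊕,
-- ⟪ α ⟫ ⊕ ⟪ β ⟫ = M ⟨ γ ⟩₅ for γ = add3 α β.  Each step of div2 replaces the leading digits
-- (a , b) of γ by (c , e) = d (a , b) with 2a + b = 4c + e, which is precisely what makes
-- ⟨ a ⟩₅ ⊕ (⟨ b ⟩₅ ⊕ x) = ⟨ c ⟩ ⊕ (⟨ e ⟩₅ ⊕ x) hold for every tail x.  Hence the values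
-- of M on the successive carried streams satisfy the defining recursion of ⟪ div2 γ ⟫,
-- and the uniqueness clause of M identifies the two.
module Submission where

open import Defs
open import Data.Nat using (ℕ; zero; suc)
open import Data.Nat.GeneralisedArithmetic using (iterate)
open import Data.Product using (proj₁; proj₂)
open import Relation.Binary.PropositionalEquality
  using (_≡_; refl; sym; trans; cong; cong₂; module ≡-Reasoning)
open import Axiom.Extensionality.Propositional using (Extensionality)
open import Level using (0ℓ)

open ≡-Reasoning

iterate-suc : {A : Set} (f : A → A) (x : A) (n : ℕ) →
              iterate f x (suc n) ≡ f (iterate f x n)
iterate-suc f x zero    = refl
iterate-suc f x (suc n) = iterate-suc f (f x) n

head-iterate-tail : {A : Set} (u : ℕ → A) (n : ℕ) → head (iterate tail u n) ≡ u n
head-iterate-tail u zero    = refl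
head-iterate-tail u (suc n) = head-iterate-tail (tail u) n

module IterativeMidpointProperties
  {B : Set} {_⊕_ : B → B → B} {M : (ℕ → B) → B} (im : IsIterativeMidpoint _⊕_ M) where

  open IsIterativeMidpoint im

  ⊕-distribˡ : ∀ a b c → a ⊕ (b ⊕ c) ≡ (a ⊕ b) ⊕ (a ⊕ c)
  ⊕-distribˡ a b c = begin
    a ⊕ (b ⊕ c)       ≡⟨ cong (_⊕ (b ⊕ c)) (sym (idem a)) ⟩
    (a ⊕ a) ⊕ (b ⊕ c) ≡⟨ transp a a b c ⟩
    (a ⊕ b) ⊕ (a ⊕ c) ∎

  -- For (l , r) = (-1 , +1) or (+1 , -1) these are the cases of d with leading digit ∓1;
  -- q, m and q′ denote the quinary digits ∓1, 0 and ±1.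
  module QuarterCarries (l r m : B) (m≡l⊕r : m ≡ l ⊕ r) where

    q q′ : B
    q  = l ⊕ m
    q′ = r ⊕ m

    m⊕q≡l⊕q′ : m ⊕ q ≡ l ⊕ q′
    m⊕q≡l⊕q′ = begin
      m ⊕ (l ⊕ m)       ≡⟨ cong (_⊕ q) m≡l⊕r ⟩
      (l ⊕ r) ⊕ (l ⊕ m) ≡⟨ sym (⊕-distribˡ l r m) ⟩
      l ⊕ (r ⊕ m)       ∎

    q⊕m≡l⊕q′ : q ⊕ m ≡ l ⊕ q′
    q⊕m≡l⊕q′ = trans (comm q m) m⊕q≡l⊕q′

    carry-l : ∀ x → q ⊕ (l ⊕ x) ≡ l ⊕ (m ⊕ x)
    carry-l x = sym (⊕-distribˡ l m x)

    carry-q : ∀ x → q ⊕ (q ⊕ x) ≡ l ⊕ (q′ ⊕ x)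
    carry-q x = begin
      (l ⊕ m) ⊕ (q ⊕ x) ≡⟨ transp l m q x ⟩
      (l ⊕ q) ⊕ (m ⊕ x) ≡⟨ cong (_⊕ (m ⊕ x)) (comm l q) ⟩
      (q ⊕ l) ⊕ (m ⊕ x) ≡⟨ transp q l m x ⟩
      (q ⊕ m) ⊕ (l ⊕ x) ≡⟨ cong (_⊕ (l ⊕ x)) q⊕m≡l⊕q′ ⟩
      (l ⊕ q′) ⊕ (l ⊕ x) ≡⟨ transp l q′ l x ⟩
      (l ⊕ l) ⊕ (q′ ⊕ x) ≡⟨ cong (_⊕ (q′ ⊕ x)) (idem l) ⟩
      l ⊕ (q′ ⊕ x)       ∎

    carry-m : ∀ x → q ⊕ (m ⊕ x) ≡ m ⊕ (l ⊕ x)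
    carry-m x = begin
      (l ⊕ m) ⊕ (m ⊕ x) ≡⟨ cong (_⊕ (m ⊕ x)) (comm l m) ⟩
      (m ⊕ l) ⊕ (m ⊕ x) ≡⟨ sym (⊕-distribˡ m l x) ⟩
      m ⊕ (l ⊕ x)       ∎

    carry-q′ : ∀ x → q ⊕ (q′ ⊕ x) ≡ m ⊕ (q ⊕ x)
    carry-q′ x = begin
      (l ⊕ m) ⊕ (q′ ⊕ x) ≡⟨ transp l m q′ x ⟩
      (l ⊕ q′) ⊕ (m ⊕ x) ≡⟨ cong (_⊕ (m ⊕ x)) (sym m⊕q≡l⊕q′) ⟩
      (m ⊕ q) ⊕ (m ⊕ x)  ≡⟨ sym (⊕-distribˡ m q x) ⟩
      m ⊕ (q ⊕ x)        ∎

    carry-r : ∀ x → q ⊕ (r ⊕ x) ≡ m ⊕ (m ⊕ x)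
    carry-r x = begin
      (l ⊕ m) ⊕ (r ⊕ x) ≡⟨ transp l m r x ⟩
      (l ⊕ r) ⊕ (m ⊕ x) ≡⟨ cong (_⊕ (m ⊕ x)) (sym m≡l⊕r) ⟩
      m ⊕ (m ⊕ x)       ∎

  M-iterate-tail : ∀ u n → M (iterate tail u n) ≡ u n ⊕ M (iterate tail u (suc n))
  M-iterate-tail u n = begin
    M (iterate tail u n)
      ≡⟨ M-eq _ ⟩
    head (iterate tail u n) ⊕ M (tail (iterate tail u n))
      ≡⟨ cong₂ _⊕_ (head-iterate-tail u n) (cong M (sym (iterate-suc tail u n))) ⟩
    u n ⊕ M (iterate tail u (suc n))
      ∎

  M-⊕ : ∀ u v → M u ⊕ M v ≡ M (λ n → u n ⊕ v n)
  M-⊕ u v = M-unique (λ n → u n ⊕ v n) (λ n → M (iterate tail u n) ⊕ M (iterate tail v n)) step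
    where
    step : ∀ n → M (iterate tail u n) ⊕ M (iterate tail v n)
               ≡ (u n ⊕ v n) ⊕ (M (iterate tail u (suc n)) ⊕ M (iterate tail v (suc n)))
    step n = trans (cong₂ _⊕_ (M-iterate-tail u n) (M-iterate-tail v n)) (transp _ _ _ _)

carry : (ℕ → 𝟝) → (ℕ → 𝟝)
carry γ = proj₂ (d (γ 0) (γ 1)) ∷ₛ tail (tail γ)

div2-iterate-carry : ∀ γ n → div2 γ n ≡ div2 (iterate carry γ n) 0
div2-iterate-carry γ zero    = refl
div2-iterate-carry γ (suc n) = div2-iterate-carry (carry γ) n

module _ (IO : IntervalObject) where

  open IntervalObject IO
  open IsIterativeMidpoint isIM
  open IterativeMidpointProperties isIM

  ⟨_⟩₃ : 𝟛 → 𝕀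
  ⟨_⟩₃ = ⟨_⟩ IO

  ⟨_⟩₅ : 𝟝 → 𝕀
  ⟨ ₋2 ⟩₅ = -1ᵢ
  ⟨ ₋1 ⟩₅ = -1ᵢ ⊕ 0ᵢ
  ⟨ ₀  ⟩₅ = 0ᵢ
  ⟨ ₁  ⟩₅ = +1ᵢ ⊕ 0ᵢ
  ⟨ ₂  ⟩₅ = +1ᵢ

  ⟨⟩-⊕-add3 : ∀ a b → ⟨ a ⟩₃ ⊕ ⟨ b ⟩₃ ≡ ⟨ add3 a b ⟩₅
  ⟨⟩-⊕-add3 𝟛.₋1 𝟛.₋1 = idem _
  ⟨⟩-⊕-add3 𝟛.₋1 𝟛.₀  = refl
  ⟨⟩-⊕-add3 𝟛.₋1 𝟛.₁  = refl
  ⟨⟩-⊕-add3 𝟛.₀  𝟛.₋1 = comm _ _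
  ⟨⟩-⊕-add3 𝟛.₀  𝟛.₀  = idem _
  ⟨⟩-⊕-add3 𝟛.₀  𝟛.₁  = comm _ _
  ⟨⟩-⊕-add3 𝟛.₁  𝟛.₋1 = comm _ _
  ⟨⟩-⊕-add3 𝟛.₁  𝟛.₀  = refl
  ⟨⟩-⊕-add3 𝟛.₁  𝟛.₁  = idem _

  private
    module Lower = QuarterCarries -1ᵢ +1ᵢ 0ᵢ refl
    module Upper = QuarterCarries +1ᵢ -1ᵢ 0ᵢ (comm -1ᵢ +1ᵢ)

  d-sound : ∀ a b x → ⟨ a ⟩₅ ⊕ (⟨ b ⟩₅ ⊕ x) ≡ ⟨ proj₁ (d a b) ⟩₃ ⊕ (⟨ proj₂ (d a b) ⟩₅ ⊕ x)
  d-sound ₋2 b  x = refl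
  d-sound ₀  b  x = refl
  d-sound ₂  b  x = refl
  d-sound ₋1 ₋2 x = Lower.carry-l x
  d-sound ₋1 ₋1 x = Lower.carry-q x
  d-sound ₋1 ₀  x = Lower.carry-m x
  d-sound ₋1 ₁  x = Lower.carry-q′ x
  d-sound ₋1 ₂  x = Lower.carry-r x
  d-sound ₁  ₋2 x = Upper.carry-r x
  d-sound ₁  ₋1 x = Upper.carry-q′ x
  d-sound ₁  ₀  x = Upper.carry-m x
  d-sound ₁  ₁  x = Upper.carry-q x
  d-sound ₁  ₂  x = Upper.carry-l x

  ⟪_⟫₅ : (ℕ → 𝟝) → 𝕀
  ⟪ γ ⟫₅ = M (λ n → ⟨ γ n ⟩₅)

  ⟪⟫₅-carry : ∀ γ → ⟪ γ ⟫₅ ≡ ⟨ div2 γ 0 ⟩₃ ⊕ ⟪ carry γ ⟫₅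
  ⟪⟫₅-carry γ = begin
    ⟪ γ ⟫₅                                                  ≡⟨ M-eq _ ⟩
    ⟨ γ 0 ⟩₅ ⊕ ⟪ tail γ ⟫₅                                  ≡⟨ cong (⟨ γ 0 ⟩₅ ⊕_) (M-eq _) ⟩
    ⟨ γ 0 ⟩₅ ⊕ (⟨ γ 1 ⟩₅ ⊕ ⟪ tail (tail γ) ⟫₅)             ≡⟨ d-sound (γ 0) (γ 1) _ ⟩
    ⟨ div2 γ 0 ⟩₃ ⊕ (⟨ carry γ 0 ⟩₅ ⊕ ⟪ tail (carry γ) ⟫₅) ≡⟨ cong (⟨ div2 γ 0 ⟩₃ ⊕_) (sym (M-eq _)) ⟩
    ⟨ div2 γ 0 ⟩₃ ⊕ ⟪ carry γ ⟫₅                            ∎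

  ⟪⟫₅≡⟪div2⟫ : ∀ γ → ⟪ γ ⟫₅ ≡ ⟪_⟫ IO (div2 γ)
  ⟪⟫₅≡⟪div2⟫ γ = M-unique _ (λ n → ⟪ iterate carry γ n ⟫₅) step
    where
    step : ∀ n → ⟪ iterate carry γ n ⟫₅ ≡ ⟨ div2 γ n ⟩₃ ⊕ ⟪ iterate carry γ (suc n) ⟫₅
    step n = begin
      ⟪ iterate carry γ n ⟫₅
        ≡⟨ ⟪⟫₅-carry (iterate carry γ n) ⟩
      ⟨ div2 (iterate carry γ n) 0 ⟩₃ ⊕ ⟪ carry (iterate carry γ n) ⟫₅
        ≡⟨ cong₂ (λ c δ → ⟨ c ⟩₃ ⊕ ⟪ δ ⟫₅)
                 (sym (div2-iterate-carry γ n)) (sym (iterate-suc carry γ n)) ⟩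
      ⟨ div2 γ n ⟩₃ ⊕ ⟪ iterate carry γ (suc n) ⟫₅
        ∎

theorem5p67 : Extensionality 0ℓ 0ℓ → (IO : IntervalObject) → (α β : ℕ → 𝟛) →
    ⟪_⟫ IO (mid α β) ≡ IntervalObject._⊕_ IO (⟪_⟫ IO α) (⟪_⟫ IO β)
theorem5p67 ext IO α β = begin
  ⟪_⟫ IO (mid α β)                       ≡⟨ sym (⟪⟫₅≡⟪div2⟫ IO γ) ⟩
  ⟪_⟫₅ IO γ                              ≡⟨ cong M (ext (λ n → sym (⟨⟩-⊕-add3 IO (α n) (β n)))) ⟩
  M (λ n → ⟨_⟩ IO (α n) ⊕ ⟨_⟩ IO (β n)) ≡⟨ sym (M-⊕ _ _) ⟩
  ⟪_⟫ IO α ⊕ ⟪_⟫ IO β                    ∎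
  where
  open IntervalObject IO
  open IterativeMidpointProperties isIM using (M-⊕)
  γ : ℕ → 𝟝
  γ n = add3 (α n) (β n)
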